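{- There is a constant $c>0$ such that the following holds for every $n\ge4$ and every partition $\mathcal{P}$ of $[n]$: let $\mathrm{Stab}_n(\mathcal{P})\le\mathrm{Alt}_n$ be the setwise stabiliser of $\mathcal{P}$ in the alternating group $\mathrm{Alt}_n$ (permutations mapping parts onto parts). Then the $\mathrm{Alt}_n$-orbit size $\frac{n!/2}{|\mathrm{Stab}_n(\mathcal{P})|}$ of $\mathcal{P}$ is at least $c n^2$, unless $\mathcal{P}$ is of one of the forms $\{[n]\}$, $\{\{s\},[n]\setminus\{s\}\}$ for some $s\in[n]$, or $\{\{s\}\mid s\in[n]\}$. -}

module Defs where

open import Data.Nat using (ℕ; zero; suc; _%_; _≡ᵇ_)
open import Data.Bool using (Bool; true; false; _∧_; _∨_; not; T)
open import Data.Fin using (Fin)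
open import Data.Fin.Properties using (_≟_; _<?_)
open import Data.List using (List; []; _∷_; map; concatMap; allFin; filterᵇ; length)
open import Data.Bool.ListAction using (and)
open import Data.Vec.Functional as VF using (Vector)
open import Relation.Nullary.Decidable using (⌊_⌋)
open import Relation.Binary.PropositionalEquality using (_≡_)
open import Data.Product using (_×_; ∃)

all : ∀ {A : Set} → (A → Bool) → List A → Bool
all p xs = and (map p xs)

_==_ : ∀ {n} → Fin n → Fin n → Bool
i == j = ⌊ i ≟ j ⌋

_<ᵇ_ : ∀ {n} → Fin n → Fin n → Bool
i <ᵇ j = ⌊ i <? j ⌋

allFuns : (k n : ℕ) → List (Fin k → Fin n)
allFuns zero    n = (λ ()) ∷ []
allFuns (suc k) n = concatMap (λ f → map (λ a → a VF.∷ f) (allFin n)) (allFuns k n)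

-- σ is injective (hence a bijection of the finite set [n])
isPermᵇ : ∀ {n} → (Fin n → Fin n) → Bool
isPermᵇ {n} σ = all (λ i → all (λ j → not (σ i == σ j) ∨ (i == j)) (allFin n)) (allFin n)

inversions : ∀ {n} → (Fin n → Fin n) → ℕ
inversions {n} σ =
  length (concatMap (λ i → filterᵇ (λ j → (i <ᵇ j) ∧ (σ j <ᵇ σ i)) (allFin n)) (allFin n))

isEvenᵇ : ∀ {n} → (Fin n → Fin n) → Bool
isEvenᵇ σ = (inversions σ % 2) ≡ᵇ 0

-- A partition of [n] = {0,…,n-1}, given by its (decidable) equivalence
-- relation "i and j lie in the same part".
record Partition (n : ℕ) : Set where
  field
    same    : Fin n → Fin n → Bool
    reflP   : ∀ i → T (same i i)
    symP    : ∀ i j → T (same i j) → T (same j i)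
    transP  : ∀ i j k → T (same i j) → T (same j k) → T (same i k)
open Partition public

stabilisesᵇ : ∀ {n} → Partition n → (Fin n → Fin n) → Bool
stabilisesᵇ {n} P σ =
  all (λ i → all (λ j → same P (σ i) (σ j) ⇔ᵇ same P i j) (allFin n)) (allFin n)
  where
  _⇔ᵇ_ : Bool → Bool → Bool
  true  ⇔ᵇ b = b
  false ⇔ᵇ b = not b

stabSize : ∀ {n} → Partition n → ℕ
stabSize {n} P =
  length (filterᵇ (λ σ → isPermᵇ σ ∧ (isEvenᵇ σ ∧ stabilisesᵇ P σ)) (allFuns n n))

IsTrivial : ∀ {n} → Partition n → Set
IsTrivial {n} P = ∀ (i j : Fin n) → same P i j ≡ true

IsPointSplit : ∀ {n} → Partition n → Set
IsPointSplit {n} P = ∃ λ (s : Fin n) → ∀ (i j : Fin n) →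
  same P i j ≡ not ((i == s) xor (j == s))
  where
  _xor_ : Bool → Bool → Bool
  true  xor b = not b
  false xor b = b

IsDiscrete : ∀ {n} → Partition n → Set
IsDiscrete {n} P = ∀ (i j : Fin n) → same P i j ≡ (i == j)

-- Write Stab(P) for the stabiliser of P in the full symmetric group; the even stabiliser
-- counted by stabSize is contained in it. If ρ₁, …, ρ_N are permutations pulling P back to
-- pairwise distinct partitions ρ_k⁻¹(P), the sets {g | ρ_k ∘ g ∈ Stab(P)} are pairwise
-- disjoint translates of Stab(P), so N · |Stab(P)| ≤ n!.
--
-- For a non-exceptional P and n ≥ 16 there is such a family of double transpositions
-- (a x)(b y) with n² ≤ 32 N:
--   * if a part T has more than n/2 points, take t ∈ T, two points a ≠ b outside T, and
--     pairs x < y in T ∖ {t};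
--   * otherwise, if u ~ v and u′ ~ v′ lie in two different parts, take a = u, b = u′,
--     x outside the part of u and y outside the part of u′;
--   * otherwise the part of u ~ v is the only non-singleton part: take a = u, b = v and
--     pairs x < y of singletons.
-- In each case x and y range over sets of sizes A, B ≥ (n − 4)/2 and N ≥ A (B − 1) / 2.
-- For n < 16 the trivial bound |Stab(P)| ≤ n! suffices, so n² |Stab(P)| ≤ 256 n! = 512 (n!/2).

module Submission where

open import Data.Bool using (Bool; true; false; _∧_; _∨_; not; T)
open import Data.Bool.Properties using (T-∧; T-∨; T-≡; T?)
open import Data.Empty using (⊥-elim)
open import Data.Fin as Fin using (Fin; zero; suc; punchOut)
import Data.Fin.Permutation.Components as PC
open import Data.Fin.Permutation
  using (Permutation′; transpose; _∘ₚ_; _⟨$⟩ʳ_; _⟨$⟩ˡ_; inverseˡ; inverseʳ; flip)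
import Data.Fin.Properties as Finₚ
open import Data.List using (List; []; _∷_; _++_; map; tabulate; allFin; concatMap; filterᵇ; length)
import Data.List.Properties as List
open import Data.Nat using (ℕ; zero; suc; _+_; _*_; _∸_; _^_; _/_; _!; _≤_; _<_; _<?_; z≤n; s≤s)
open import Data.Nat.Combinatorics.Base using (_P′_)
open import Data.Nat.Combinatorics.Specification using (nP′n≡n!)
open import Data.Nat.Divisibility using (_∣_; m≤n⇒m!∣n!; m∣n⇒n≡m*quotient; n/m≡quotient)
open import Data.Nat.ListAction using () renaming (sum to sumₗ)
open import Data.Nat.ListAction.Properties using (sum-++)
open import Data.Nat.Properties
open import Algebra.Properties.Semiring.Sum +-*-semiring
  using (sum; sum-syntax; sum-cong-≗; sum-replicate-zero; ∑-comm; ∑-permute; ∑-distrib-+; *-distribʳ-sum)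
open import Data.Nat.Tactic.RingSolver using (solve-∀)
open import Data.Product using (Σ; ∃; ∃₂; _×_; _,_; proj₁; proj₂)
open import Data.Sum using (_⊎_; inj₁; inj₂; [_,_]′)
open import Data.Unit using (tt)
import Data.Vec.Functional as Vector
open import Function using (_∘_; id; Equivalence; Injection)
open import Function.Definitions using (Injective)
open import Function.Properties.Inverse using (↔⇒↣)
open import Relation.Binary.Definitions using (tri<; tri≈; tri>)
open import Relation.Binary.PropositionalEquality
open import Relation.Nullary using (¬_; ¬?; Dec; yes; no; contradiction)
open import Relation.Nullary.Decidable
  using (decidable-stable; dec-true; dec-false; _×-dec_; ⌊⌋-map′; toWitness; fromWitness; toWitnessFalse; fromWitnessFalse)

open import Defs

-- Indicators and finite sums

⟦_⟧ : Bool → ℕ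
⟦ true ⟧  = 1
⟦ false ⟧ = 0

⟦⟧≤1 : ∀ b → ⟦ b ⟧ ≤ 1
⟦⟧≤1 true  = ≤-refl
⟦⟧≤1 false = z≤n

⟦⟧-pos : ∀ {b} → 0 < ⟦ b ⟧ → T b
⟦⟧-pos {true} _ = tt

⟦⟧-mono : ∀ {a b} → (T a → T b) → ⟦ a ⟧ ≤ ⟦ b ⟧
⟦⟧-mono {false}         _   = z≤n
⟦⟧-mono {true} {true}   _   = ≤-refl
⟦⟧-mono {true} {false} a⇒b = ⊥-elim (a⇒b tt)

⟦∧⟧ : ∀ a b → ⟦ a ⟧ * ⟦ b ⟧ ≡ ⟦ a ∧ b ⟧
⟦∧⟧ true  b = +-identityʳ ⟦ b ⟧
⟦∧⟧ false b = refl

⟦∨⟧≤ : ∀ a b → ⟦ a ∨ b ⟧ ≤ ⟦ a ⟧ + ⟦ b ⟧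
⟦∨⟧≤ true  b = s≤s z≤n
⟦∨⟧≤ false b = ≤-refl

T-not⁻ : ∀ {b} → T (not b) → ¬ T b
T-not⁻ {false} _ ()

¬T⇒≡false : ∀ {b} → ¬ T b → b ≡ false
¬T⇒≡false {true}  ¬b = ⊥-elim (¬b tt)
¬T⇒≡false {false} _  = refl

⟦⟧-false : ∀ {b} → ¬ T b → ⟦ b ⟧ ≡ 0
⟦⟧-false = cong ⟦_⟧ ∘ ¬T⇒≡false

T-injective : ∀ {a b} → (T a → T b) → (T b → T a) → a ≡ b
T-injective {true}  {true}  _   _   = refl
T-injective {true}  {false} a⇒b _   = ⊥-elim (a⇒b tt)
T-injective {false} {true}  _   b⇒a = ⊥-elim (b⇒a tt)
T-injective {false} {false} _   _   = refl

all-tabulate⁻ : ∀ {A : Set} {n} (p : A → Bool) (g : Fin n → A) →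
                T (all p (tabulate g)) → ∀ i → T (p (g i))
all-tabulate⁻ p g t zero    = proj₁ (Equivalence.to (T-∧ {p (g zero)}) t)
all-tabulate⁻ p g t (suc i) = all-tabulate⁻ p (g ∘ suc) (proj₂ (Equivalence.to (T-∧ {p (g zero)}) t)) i

all-tabulate⁺ : ∀ {A : Set} {n} (p : A → Bool) (g : Fin n → A) →
                (∀ i → T (p (g i))) → T (all p (tabulate g))
all-tabulate⁺ {n = zero}  p g h = tt
all-tabulate⁺ {n = suc n} p g h = Equivalence.from T-∧ (h zero , all-tabulate⁺ p (g ∘ suc) (h ∘ suc))

all-tabulate-violated : ∀ {A : Set} {n} (p : A → Bool) (g : Fin n → A) →
                        ¬ T (all p (tabulate g)) → ∃ λ i → ¬ T (p (g i))
all-tabulate-violated {n = n} p g ¬all = Finₚ.¬∀⟶∃¬ n _ (λ i → T? (p (g i))) (¬all ∘ all-tabulate⁺ p g)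

∑-mono-≤ : ∀ {n} {f g : Fin n → ℕ} → (∀ i → f i ≤ g i) → sum f ≤ sum g
∑-mono-≤ {zero}  f≤g = z≤n
∑-mono-≤ {suc n} f≤g = +-mono-≤ (f≤g zero) (∑-mono-≤ (f≤g ∘ suc))

∑-ones : ∀ n → ∑[ i < n ] 1 ≡ n
∑-ones zero    = refl
∑-ones (suc n) = cong suc (∑-ones n)

∑-≤-size : ∀ {n} {f : Fin n → ℕ} → (∀ i → f i ≤ 1) → sum f ≤ n
∑-≤-size {n} f≤1 = ≤-trans (∑-mono-≤ f≤1) (≤-reflexive (∑-ones n))

∑-zero : ∀ {n} {f : Fin n → ℕ} → (∀ i → f i ≡ 0) → sum f ≡ 0
∑-zero {n} f≡0 = trans (sum-cong-≗ f≡0) (sum-replicate-zero n)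

∑-pos : ∀ {n} (f : Fin n → ℕ) → 0 < sum f → ∃ λ i → 0 < f i
∑-pos {suc n} f pos with f zero in eq
... | suc _ = zero , subst (0 <_) (sym eq) (s≤s z≤n)
... | zero  with ∑-pos (f ∘ suc) pos
...   | i , fi>0 = suc i , fi>0

∑-≤1 : ∀ {n} (f : Fin n → ℕ) → (∀ i → f i ≤ 1) →
       (∀ {i j} → 0 < f i → 0 < f j → i ≡ j) → sum f ≤ 1
∑-≤1 {zero}  f f≤1 unique = z≤n
∑-≤1 {suc n} f f≤1 unique with f zero in eq
... | zero  = ∑-≤1 (f ∘ suc) (f≤1 ∘ suc) (λ p q → Finₚ.suc-injective (unique p q))
... | suc m = begin
  suc m + sum (f ∘ suc) ≡⟨ cong (suc m +_) (∑-zero rest≡0) ⟩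
  suc m + 0             ≡⟨ +-identityʳ (suc m) ⟩
  suc m                 ≡⟨ eq ⟨
  f zero                ≤⟨ f≤1 zero ⟩
  1                     ∎
  where
  open ≤-Reasoning
  rest≡0 : ∀ i → f (suc i) ≡ 0
  rest≡0 i with 0 <? f (suc i)
  ... | yes pos = contradiction (unique (subst (0 <_) (sym eq) (s≤s z≤n)) pos) λ ()
  ... | no ¬pos = n≤0⇒n≡0 (≮⇒≥ ¬pos)

==-suc : ∀ {n} (i j : Fin n) → (suc i == suc j) ≡ (i == j)
==-suc i j = ⌊⌋-map′ (cong suc) Finₚ.suc-injective (i Finₚ.≟ j)

∑-point : ∀ {n} (i : Fin n) → ∑[ j < n ] ⟦ i == j ⟧ ≡ 1
∑-point {suc n} zero    = cong suc (sum-replicate-zero n)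
∑-point {suc n} (suc i) = trans (sum-cong-≗ (cong ⟦_⟧ ∘ ==-suc i)) (∑-point i)

-- Counting permutations

module _ {A : Set} where

  sumₗ-cong : ∀ {f g : A → ℕ} → (∀ x → f x ≡ g x) → ∀ xs → sumₗ (map f xs) ≡ sumₗ (map g xs)
  sumₗ-cong f≗g xs = cong sumₗ (List.map-cong f≗g xs)

  sumₗ-mono-≤ : ∀ {f g : A → ℕ} → (∀ x → f x ≤ g x) → ∀ xs → sumₗ (map f xs) ≤ sumₗ (map g xs)
  sumₗ-mono-≤ f≤g []       = z≤n
  sumₗ-mono-≤ f≤g (x ∷ xs) = +-mono-≤ (f≤g x) (sumₗ-mono-≤ f≤g xs)

  *-distribˡ-sumₗ : ∀ c (f : A → ℕ) xs → c * sumₗ (map f xs) ≡ sumₗ (map (λ x → c * f x) xs)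
  *-distribˡ-sumₗ c f []       = *-zeroʳ c
  *-distribˡ-sumₗ c f (x ∷ xs) = trans (*-distribˡ-+ c (f x) _) (cong (c * f x +_) (*-distribˡ-sumₗ c f xs))

  sumₗ-∑-comm : ∀ {m} (w : Fin m → A → ℕ) xs →
                sumₗ (map (λ x → ∑[ a < m ] w a x) xs) ≡ ∑[ a < m ] sumₗ (map (w a) xs)
  sumₗ-∑-comm {m} w []       = sym (sum-replicate-zero m)
  sumₗ-∑-comm w (x ∷ xs) = trans (cong (sum (λ a → w a x) +_) (sumₗ-∑-comm w xs))
                                 (sym (∑-distrib-+ (λ a → w a x) _))

  sumₗ-tabulate : ∀ {n} (g : Fin n → A) (h : A → ℕ) → sumₗ (map h (tabulate g)) ≡ sum (h ∘ g)
  sumₗ-tabulate {zero}  g h = refl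
  sumₗ-tabulate {suc n} g h = cong (h (g zero) +_) (sumₗ-tabulate (g ∘ suc) h)

  length-filterᵇ : ∀ (p : A → Bool) xs → length (filterᵇ p xs) ≡ sumₗ (map (⟦_⟧ ∘ p) xs)
  length-filterᵇ p []       = refl
  length-filterᵇ p (x ∷ xs) with p x
  ... | true  = cong suc (length-filterᵇ p xs)
  ... | false = length-filterᵇ p xs

sumₗ-concatMap : ∀ {A B : Set} (w : B → ℕ) (F : A → List B) xs →
                 sumₗ (map w (concatMap F xs)) ≡ sumₗ (map (λ x → sumₗ (map w (F x))) xs)
sumₗ-concatMap w F []       = refl
sumₗ-concatMap w F (x ∷ xs) = begin
  sumₗ (map w (F x ++ concatMap F xs))                ≡⟨ cong sumₗ (List.map-++ w (F x) _) ⟩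
  sumₗ (map w (F x) ++ map w (concatMap F xs))        ≡⟨ sum-++ (map w (F x)) _ ⟩
  sumₗ (map w (F x)) + sumₗ (map w (concatMap F xs))  ≡⟨ cong (sumₗ (map w (F x)) +_) (sumₗ-concatMap w F xs) ⟩
  sumₗ (map w (F x)) + sumₗ (map (λ x → sumₗ (map w (F x))) xs) ∎
  where open ≡-Reasoning

∑Fun : ∀ k n → ((Fin k → Fin n) → ℕ) → ℕ
∑Fun k n w = sumₗ (map w (allFuns k n))

∑Fun-suc : ∀ k n w → ∑Fun (suc k) n w ≡ ∑Fun k n (λ f → ∑[ a < n ] w (a Vector.∷ f))
∑Fun-suc k n w = trans (sumₗ-concatMap w _ (allFuns k n)) (sumₗ-cong sum-extensions (allFuns k n))
  where
  sum-extensions : ∀ f → sumₗ (map w (map (Vector._∷ f) (allFin n))) ≡ ∑[ a < n ] w (a Vector.∷ f)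
  sum-extensions f = trans (cong sumₗ (sym (List.map-∘ (allFin n)))) (sumₗ-tabulate id (λ a → w (a Vector.∷ f)))

Extensional : ∀ {k n} → ((Fin k → Fin n) → ℕ) → Set
Extensional w = ∀ f g → (∀ i → f i ≡ g i) → w f ≡ w g

∑Fun-permute : ∀ k n (π : Permutation′ n) (w : (Fin k → Fin n) → ℕ) → Extensional w →
               ∑Fun k n (λ f → w ((π ⟨$⟩ʳ_) ∘ f)) ≡ ∑Fun k n w
∑Fun-permute zero    n π w ext = cong (_+ 0) (ext _ _ (λ ()))
∑Fun-permute (suc k) n π w ext = begin
  ∑Fun (suc k) n (λ f → w (π′ ∘ f))                     ≡⟨ ∑Fun-suc k n _ ⟩
  ∑Fun k n (λ f → ∑[ a < n ] w (π′ ∘ (a Vector.∷ f)))   ≡⟨ sumₗ-cong (λ f → sum-cong-≗ (ext _ _ ∘ π-∷ f)) fs ⟩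
  ∑Fun k n (λ f → ∑[ a < n ] w (π′ a Vector.∷ π′ ∘ f))  ≡⟨ sumₗ-cong (λ f → sym (∑-permute (extend (π′ ∘ f)) π)) fs ⟩
  ∑Fun k n (λ f → extensions (π′ ∘ f))                  ≡⟨ ∑Fun-permute k n π extensions extensions-ext ⟩
  ∑Fun k n extensions                                   ≡⟨ ∑Fun-suc k n w ⟨
  ∑Fun (suc k) n w                                      ∎
  where
  open ≡-Reasoning
  fs : List (Fin k → Fin n)
  fs = allFuns k n
  π′ : Fin n → Fin n
  π′ = π ⟨$⟩ʳ_
  π-∷ : ∀ f a i → (π′ ∘ (a Vector.∷ f)) i ≡ (π′ a Vector.∷ π′ ∘ f) i
  π-∷ f a zero    = refl
  π-∷ f a (suc i) = refl
  extend : (Fin k → Fin n) → Fin n → ℕ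
  extend f a = w (a Vector.∷ f)
  extensions : (Fin k → Fin n) → ℕ
  extensions f = ∑[ a < n ] extend f a
  extensions-ext : Extensional extensions
  extensions-ext f g f≗g = sum-cong-≗ (λ a → ext (a Vector.∷ f) (a Vector.∷ g) (λ { zero → refl ; (suc i) → f≗g i }))

injectiveᵇ-row : ∀ {k n} → (Fin k → Fin n) → Fin k → Bool
injectiveᵇ-row {k} f i = all (λ j → not (f i == f j) ∨ (i == j)) (allFin k)

-- at k = n, injectiveᵇ is definitionally isPermᵇ
injectiveᵇ : ∀ {k n} → (Fin k → Fin n) → Bool
injectiveᵇ {k} f = all (injectiveᵇ-row f) (allFin k)

implicationᵇ⁻ : ∀ {k n} {a b : Fin n} {c d : Fin k} → T (not (a == b) ∨ (c == d)) → a ≡ b → c ≡ d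
implicationᵇ⁻ {a = a} {b} {c} {d} t a≡b with Equivalence.to (T-∨ {not (a == b)}) t
... | inj₁ a≢b = contradiction a≡b (toWitnessFalse {a? = a Finₚ.≟ b} a≢b)
... | inj₂ c≡d = toWitness {a? = c Finₚ.≟ d} c≡d

implicationᵇ⁺ : ∀ {k n} {a b : Fin n} {c d : Fin k} → (a ≡ b → c ≡ d) → T (not (a == b) ∨ (c == d))
implicationᵇ⁺ {a = a} {b} {c} {d} a⇒c = Equivalence.from (T-∨ {not (a == b)} {c == d}) (by-cases (a Finₚ.≟ b))
  where
  by-cases : Dec (a ≡ b) → T (not (a == b)) ⊎ T (c == d)
  by-cases (yes a≡b) = inj₂ (fromWitness {a? = c Finₚ.≟ d} (a⇒c a≡b))
  by-cases (no  a≢b) = inj₁ (fromWitnessFalse {a? = a Finₚ.≟ b} a≢b)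

injectiveᵇ⁻ : ∀ {k n} (f : Fin k → Fin n) → T (injectiveᵇ f) → Injective _≡_ _≡_ f
injectiveᵇ⁻ {k} f t {i} {j} =
  implicationᵇ⁻ (all-tabulate⁻ _ id (all-tabulate⁻ (injectiveᵇ-row f) id t i) j)

injectiveᵇ⁺ : ∀ {k n} (f : Fin k → Fin n) → Injective _≡_ _≡_ f → T (injectiveᵇ f)
injectiveᵇ⁺ {k} f inj =
  all-tabulate⁺ (injectiveᵇ-row f) id (λ i → all-tabulate⁺ (λ j → not (f i == f j) ∨ (i == j)) id (λ j → implicationᵇ⁺ inj))

fibre : ∀ {k n} → (Fin k → Fin n) → Fin n → ℕ
fibre {k} f a = ∑[ i < k ] ⟦ f i == a ⟧

∑-fibre : ∀ {k n} (f : Fin k → Fin n) → ∑[ a < n ] fibre f a ≡ k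
∑-fibre {k} {n} f = begin
  ∑[ a < n ] ∑[ i < k ] ⟦ f i == a ⟧ ≡⟨ ∑-comm (λ a i → ⟦ f i == a ⟧) ⟩
  ∑[ i < k ] ∑[ a < n ] ⟦ f i == a ⟧ ≡⟨ sum-cong-≗ (λ i → ∑-point (f i)) ⟩
  ∑[ i < k ] 1                       ≡⟨ ∑-ones k ⟩
  k                                  ∎
  where open ≡-Reasoning

fibre≤1 : ∀ {k n} {f : Fin k → Fin n} → Injective _≡_ _≡_ f → ∀ a → fibre f a ≤ 1
fibre≤1 inj a = ∑-≤1 _ (λ i → ⟦⟧≤1 _) (λ p q → inj (trans (toWitness (⟦⟧-pos p)) (sym (toWitness (⟦⟧-pos q)))))

extension+fibre≤1 : ∀ {k n} {f : Fin k → Fin n} → Injective _≡_ _≡_ f →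
                    ∀ a → ⟦ injectiveᵇ (a Vector.∷ f) ⟧ + fibre f a ≤ 1
extension+fibre≤1 {f = f} inj a with injectiveᵇ (a Vector.∷ f) in eq
... | false = fibre≤1 inj a
... | true  = s≤s (≤-reflexive (∑-zero (λ i → ⟦⟧-false (λ t → fresh i (toWitness t)))))
  where
  fresh : ∀ i → f i ≢ a
  fresh i fi≡a with () ← injectiveᵇ⁻ (a Vector.∷ f) (subst T (sym eq) tt) {suc i} {zero} fi≡a

∑-extensions≤ : ∀ {k n} (f : Fin k → Fin n) →
                ∑[ a < n ] ⟦ injectiveᵇ (a Vector.∷ f) ⟧ ≤ (n ∸ k) * ⟦ injectiveᵇ f ⟧
∑-extensions≤ {k} {n} f with injectiveᵇ f in eq
... | false = ≤-reflexive (trans (∑-zero (λ a → ⟦⟧-false (tail-injective a))) (sym (*-zeroʳ (n ∸ k))))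
  where
  tail-injective : ∀ a → ¬ T (injectiveᵇ (a Vector.∷ f))
  tail-injective a t = subst T eq (injectiveᵇ⁺ f (Finₚ.suc-injective ∘ injectiveᵇ⁻ (a Vector.∷ f) t))
... | true  = begin
  sum extends  ≤⟨ m+n≤o⇒m≤o∸n (sum extends) extends+k≤n ⟩
  n ∸ k        ≡⟨ *-identityʳ (n ∸ k) ⟨
  (n ∸ k) * 1  ∎
  where
  open ≤-Reasoning
  extends : Fin n → ℕ
  extends a = ⟦ injectiveᵇ (a Vector.∷ f) ⟧
  extends+k≤n : sum extends + k ≤ n
  extends+k≤n = begin
    sum extends + k                     ≡⟨ cong (sum extends +_) (∑-fibre f) ⟨
    sum extends + ∑[ a < n ] fibre f a  ≡⟨ ∑-distrib-+ extends (fibre f) ⟨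
    ∑[ a < n ] (extends a + fibre f a)  ≤⟨ ∑-≤-size (extension+fibre≤1 (injectiveᵇ⁻ f (subst T (sym eq) tt))) ⟩
    n                                   ∎

∑Fun-injective≤ : ∀ k n → ∑Fun k n (⟦_⟧ ∘ injectiveᵇ) ≤ n P′ k
∑Fun-injective≤ zero    n = ≤-refl
∑Fun-injective≤ (suc k) n = begin
  ∑Fun (suc k) n (⟦_⟧ ∘ injectiveᵇ)                          ≡⟨ ∑Fun-suc k n _ ⟩
  ∑Fun k n (λ f → ∑[ a < n ] ⟦ injectiveᵇ (a Vector.∷ f) ⟧)  ≤⟨ sumₗ-mono-≤ ∑-extensions≤ (allFuns k n) ⟩
  ∑Fun k n (λ f → (n ∸ k) * ⟦ injectiveᵇ f ⟧)                ≡⟨ *-distribˡ-sumₗ (n ∸ k) _ (allFuns k n) ⟨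
  (n ∸ k) * ∑Fun k n (⟦_⟧ ∘ injectiveᵇ)                      ≤⟨ *-monoʳ-≤ (n ∸ k) (∑Fun-injective≤ k n) ⟩
  (n ∸ k) * (n P′ k)                                         ∎
  where open ≤-Reasoning

∑Fun-permutations≤ : ∀ n → ∑Fun n n (⟦_⟧ ∘ isPermᵇ) ≤ n !
∑Fun-permutations≤ n = subst (∑Fun n n (⟦_⟧ ∘ isPermᵇ) ≤_) (nP′n≡n! n) (∑Fun-injective≤ n n)

injective⇒surjective : ∀ {n} {f : Fin n → Fin n} → Injective _≡_ _≡_ f → ∀ a → ∃ λ i → f i ≡ a
injective⇒surjective {suc n} {f} inj a with Finₚ.any? (λ i → f i Finₚ.≟ a)
... | yes hit = hit
... | no  miss = contradiction (Finₚ.injective⇒≤ squeezed-injective) (<-irrefl refl)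
  where
  missed : ∀ i → a ≢ f i
  missed i a≡fi = miss (i , sym a≡fi)
  squeezed : Fin (suc n) → Fin n
  squeezed i = punchOut (missed i)
  squeezed-injective : Injective _≡_ _≡_ squeezed
  squeezed-injective {i} {j} e = inj (Finₚ.punchOut-injective (missed i) (missed j) e)

-- Stabilisers and the packing bound

pairs : ∀ {n} → (Fin n → Fin n → Bool) → ℕ
pairs {n} R = ∑[ x < n ] ∑[ y < n ] ⟦ R x y ⟧

pairs-*ʳ : ∀ {n} (R : Fin n → Fin n → Bool) c → pairs R * c ≡ ∑[ x < n ] ∑[ y < n ] (⟦ R x y ⟧ * c)
pairs-*ʳ {n} R c = trans (*-distribʳ-sum c (λ x → ∑[ y < n ] ⟦ R x y ⟧))
                         (sum-cong-≗ (λ x → *-distribʳ-sum c (λ y → ⟦ R x y ⟧)))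

sumₗ-pairs-comm : ∀ {A : Set} {n} (R : A → Fin n → Fin n → Bool) xs →
  sumₗ (map (pairs ∘ R) xs) ≡ ∑[ x < n ] ∑[ y < n ] sumₗ (map (λ a → ⟦ R a x y ⟧) xs)
sumₗ-pairs-comm {n = n} R xs = trans (sumₗ-∑-comm (λ x a → ∑[ y < n ] ⟦ R a x y ⟧) xs)
                                     (sum-cong-≗ (λ x → sumₗ-∑-comm (λ y a → ⟦ R a x y ⟧) xs))

pairs-zero : ∀ {n} (R : Fin n → Fin n → Bool) → (∀ x y → ¬ T (R x y)) → pairs R ≡ 0
pairs-zero R none = ∑-zero (λ x → ∑-zero (λ y → ⟦⟧-false (none x y)))

pairs-≤1 : ∀ {n} (R : Fin n → Fin n → Bool) →
           (∀ {x y x′ y′} → T (R x y) → T (R x′ y′) → x ≡ x′ × y ≡ y′) → pairs R ≤ 1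
pairs-≤1 {n} R unique = ∑-≤1 _ row≤1 (λ p q → proj₁ (unique (proj₂ (witness p)) (proj₂ (witness q))))
  where
  row≤1 : ∀ x → ∑[ y < n ] ⟦ R x y ⟧ ≤ 1
  row≤1 x = ∑-≤1 _ (λ y → ⟦⟧≤1 (R x y)) (λ p q → proj₂ (unique (⟦⟧-pos p) (⟦⟧-pos q)))
  witness : ∀ {x} → 0 < ∑[ y < n ] ⟦ R x y ⟧ → ∃ λ y → T (R x y)
  witness pos with y , p ← ∑-pos _ pos = y , ⟦⟧-pos p

Stabilises : ∀ {n} → Partition n → (Fin n → Fin n) → Set
Stabilises {n} P σ = ∀ i j → same P (σ i) (σ j) ≡ same P i j

stabilisesᵇ⁻ : ∀ {n} (P : Partition n) (σ : Fin n → Fin n) → T (stabilisesᵇ P σ) → Stabilises P σ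
stabilisesᵇ⁻ {n} P σ t i j with same P (σ i) (σ j) | same P i j | all-tabulate⁻ _ id (all-tabulate⁻ _ id t i) j
... | true  | true  | _ = refl
... | false | false | _ = refl

-- The connective comparing the two sides in stabilisesᵇ is local to Defs, so an entry only
-- computes once both sides are known; hence the detour through a violated entry.
stabilisesᵇ⁺ : ∀ {n} (P : Partition n) (σ : Fin n → Fin n) → Stabilises P σ → T (stabilisesᵇ P σ)
stabilisesᵇ⁺ {n} P σ stab with T? (stabilisesᵇ P σ)
... | yes t = t
... | no ¬t
  with i , ¬row   ← all-tabulate-violated _ id ¬t
  with j , ¬entry ← all-tabulate-violated _ id ¬row
  with same P (σ i) (σ j) | same P i j | stab i j | ¬entry
... | true  | true  | refl | ¬tt = ⊥-elim (¬tt tt)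
... | false | false | refl | ¬tt = ⊥-elim (¬tt tt)

isPermᵇ-cong : ∀ {n} {f g : Fin n → Fin n} → (∀ i → f i ≡ g i) → isPermᵇ f ≡ isPermᵇ g
isPermᵇ-cong {f = f} {g} f≗g = T-injective
  (λ t → injectiveᵇ⁺ g (λ {i} {j} e → injectiveᵇ⁻ f t (trans (f≗g i) (trans e (sym (f≗g j))))))
  (λ t → injectiveᵇ⁺ f (λ {i} {j} e → injectiveᵇ⁻ g t (trans (sym (f≗g i)) (trans e (f≗g j)))))

isPermᵇ-∘ : ∀ {n} (π : Permutation′ n) (f : Fin n → Fin n) → isPermᵇ ((π ⟨$⟩ʳ_) ∘ f) ≡ isPermᵇ f
isPermᵇ-∘ π f = T-injective
  (λ t → injectiveᵇ⁺ f (λ e → injectiveᵇ⁻ ((π ⟨$⟩ʳ_) ∘ f) t (cong (π ⟨$⟩ʳ_) e)))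
  (λ t → injectiveᵇ⁺ ((π ⟨$⟩ʳ_) ∘ f) (λ {i} {j} e → injectiveᵇ⁻ f t (begin
    f i                     ≡⟨ inverseˡ π ⟨
    π ⟨$⟩ˡ (π ⟨$⟩ʳ f i)     ≡⟨ cong (π ⟨$⟩ˡ_) e ⟩
    π ⟨$⟩ˡ (π ⟨$⟩ʳ f j)     ≡⟨ inverseˡ π ⟩
    f j                     ∎)))
  where open ≡-Reasoning

stabilisesᵇ-cong : ∀ {n} (P : Partition n) {f g : Fin n → Fin n} → (∀ i → f i ≡ g i) →
                   stabilisesᵇ P f ≡ stabilisesᵇ P g
stabilisesᵇ-cong P {f} {g} f≗g = T-injective
  (λ t → stabilisesᵇ⁺ P g (λ i j → trans (cong₂ (same P) (sym (f≗g i)) (sym (f≗g j))) (stabilisesᵇ⁻ P f t i j)))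
  (λ t → stabilisesᵇ⁺ P f (λ i j → trans (cong₂ (same P) (f≗g i) (f≗g j)) (stabilisesᵇ⁻ P g t i j)))

symStabSize : ∀ {n} → Partition n → ℕ
symStabSize {n} P = ∑Fun n n (λ σ → ⟦ isPermᵇ σ ∧ stabilisesᵇ P σ ⟧)

stabSize≤symStabSize : ∀ {n} (P : Partition n) → stabSize P ≤ symStabSize P
stabSize≤symStabSize {n} P = begin
  stabSize P                                                     ≡⟨ length-filterᵇ _ (allFuns n n) ⟩
  ∑Fun n n (λ σ → ⟦ isPermᵇ σ ∧ (isEvenᵇ σ ∧ stabilisesᵇ P σ) ⟧) ≤⟨ sumₗ-mono-≤ forget-parity (allFuns n n) ⟩
  symStabSize P                                                  ∎
  where
  open ≤-Reasoning
  drop-parity : ∀ {a b c} → T (a ∧ (b ∧ c)) → T (a ∧ c)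
  drop-parity {true} {true} t = t
  drop-parity {true} {false} ()
  forget-parity : ∀ σ → ⟦ isPermᵇ σ ∧ (isEvenᵇ σ ∧ stabilisesᵇ P σ) ⟧ ≤ ⟦ isPermᵇ σ ∧ stabilisesᵇ P σ ⟧
  forget-parity σ = ⟦⟧-mono (drop-parity {isPermᵇ σ} {isEvenᵇ σ})

symStabSize-translate : ∀ {n} (P : Partition n) (π : Permutation′ n) →
  symStabSize P ≡ ∑Fun n n (λ g → ⟦ isPermᵇ g ∧ stabilisesᵇ P ((π ⟨$⟩ʳ_) ∘ g) ⟧)
symStabSize-translate {n} P π = begin
  symStabSize P                         ≡⟨ sumₗ-cong (λ f → cong ⟦_⟧ (cong₂ _∧_ (sym (isPermᵇ-∘ (flip π) f))
                                             (stabilisesᵇ-cong P (λ i → sym (inverseʳ π))))) (allFuns n n) ⟩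
  ∑Fun n n (λ f → w ((π ⟨$⟩ˡ_) ∘ f))    ≡⟨ ∑Fun-permute n n (flip π) w w-ext ⟩
  ∑Fun n n w                            ∎
  where
  open ≡-Reasoning
  w : (Fin n → Fin n) → ℕ
  w g = ⟦ isPermᵇ g ∧ stabilisesᵇ P ((π ⟨$⟩ʳ_) ∘ g) ⟧
  w-ext : Extensional w
  w-ext f g f≗g = cong ⟦_⟧ (cong₂ _∧_ (isPermᵇ-cong f≗g) (stabilisesᵇ-cong P (cong (π ⟨$⟩ʳ_) ∘ f≗g)))

Distinguishes : ∀ {n} → Partition n → (Fin n → Fin n) → (Fin n → Fin n) → Set
Distinguishes P σ σ′ = ∃₂ λ i j → same P (σ i) (σ j) ≢ same P (σ′ i) (σ′ j)

stabilising-translates⇒¬Distinguishes : ∀ {n} (P : Partition n) {σ σ′ g : Fin n → Fin n} →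
  Injective _≡_ _≡_ g → Stabilises P (σ ∘ g) → Stabilises P (σ′ ∘ g) → ¬ Distinguishes P σ σ′
stabilising-translates⇒¬Distinguishes P {g = g} inj stab stab′ (i , j , differ)
  with i₀ , refl ← injective⇒surjective inj i
  with j₀ , refl ← injective⇒surjective inj j
  = differ (trans (stab i₀ j₀) (sym (stab′ i₀ j₀)))

record SeparatingFamily {n} (P : Partition n) : Set where
  field
    member    : Fin n → Fin n → Bool
    ρ         : Fin n → Fin n → Permutation′ n
    separates : ∀ {x y x′ y′} → T (member x y) → T (member x′ y′) → ¬ (x ≡ x′ × y ≡ y′) →
                Distinguishes P (ρ x y ⟨$⟩ʳ_) (ρ x′ y′ ⟨$⟩ʳ_)

  size : ℕ
  size = pairs member

packing : ∀ {n} {P : Partition n} (F : SeparatingFamily P) → SeparatingFamily.size F * symStabSize P ≤ n !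
packing {n} {P} F = begin
  size * symStabSize P                                    ≡⟨ pairs-*ʳ member (symStabSize P) ⟩
  ∑[ x < n ] ∑[ y < n ] (⟦ member x y ⟧ * symStabSize P)  ≡⟨ sum-cong-≗ (sum-cong-≗ ∘ translate) ⟩
  ∑[ x < n ] ∑[ y < n ] ∑Fun n n (λ g → ⟦ hit g x y ⟧)    ≡⟨ sumₗ-pairs-comm hit (allFuns n n) ⟨
  ∑Fun n n (pairs ∘ hit)                                  ≤⟨ sumₗ-mono-≤ hits≤perm (allFuns n n) ⟩
  ∑Fun n n (⟦_⟧ ∘ isPermᵇ)                                ≤⟨ ∑Fun-permutations≤ n ⟩
  n !                                                     ∎
  where
  open ≤-Reasoning
  open SeparatingFamily F

  translated : Fin n → Fin n → (Fin n → Fin n) → Bool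
  translated x y g = isPermᵇ g ∧ stabilisesᵇ P ((ρ x y ⟨$⟩ʳ_) ∘ g)

  hit : (Fin n → Fin n) → Fin n → Fin n → Bool
  hit g x y = member x y ∧ translated x y g

  translate : ∀ x y → ⟦ member x y ⟧ * symStabSize P ≡ ∑Fun n n (λ g → ⟦ hit g x y ⟧)
  translate x y = begin-equality
    ⟦ member x y ⟧ * symStabSize P                         ≡⟨ cong (⟦ member x y ⟧ *_) (symStabSize-translate P (ρ x y)) ⟩
    ⟦ member x y ⟧ * ∑Fun n n (⟦_⟧ ∘ translated x y)       ≡⟨ *-distribˡ-sumₗ ⟦ member x y ⟧ _ (allFuns n n) ⟩
    ∑Fun n n (λ g → ⟦ member x y ⟧ * ⟦ translated x y g ⟧) ≡⟨ sumₗ-cong (λ g → ⟦∧⟧ (member x y) _) (allFuns n n) ⟩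
    ∑Fun n n (λ g → ⟦ hit g x y ⟧)                         ∎

  split : ∀ {g x y} → T (hit g x y) → T (member x y) × Injective _≡_ _≡_ g × Stabilises P ((ρ x y ⟨$⟩ʳ_) ∘ g)
  split {g} {x} {y} t with m , rest ← Equivalence.to (T-∧ {member x y}) t
                      with perm , stab ← Equivalence.to (T-∧ {isPermᵇ g}) rest
    = m , injectiveᵇ⁻ g perm , stabilisesᵇ⁻ P _ stab

  unique : ∀ {g x y x′ y′} → T (hit g x y) → T (hit g x′ y′) → x ≡ x′ × y ≡ y′
  unique {g} {x} {y} {x′} {y′} t t′ with (x Finₚ.≟ x′) ×-dec (y Finₚ.≟ y′)
  ... | yes same-index = same-index
  ... | no  different  with m , inj , stab ← split t with m′ , _ , stab′ ← split t′
    = ⊥-elim (stabilising-translates⇒¬Distinguishes P inj stab stab′ (separates m m′ different))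

  hits≤perm : ∀ g → pairs (hit g) ≤ ⟦ isPermᵇ g ⟧
  hits≤perm g with T? (isPermᵇ g)
  ... | yes perm = ≤-trans (pairs-≤1 (hit g) unique) (⟦⟧-mono {true} (λ _ → perm))
  ... | no ¬perm = ≤-trans (≤-reflexive (pairs-zero (hit g) no-hit)) z≤n
    where
    no-hit : ∀ x y → ¬ T (hit g x y)
    no-hit x y = ¬perm ∘ injectiveᵇ⁺ g ∘ proj₁ ∘ proj₂ ∘ split

-- Double transpositions

transpose-matchʳ : ∀ {n} (i j : Fin n) → PC.transpose i j j ≡ i
transpose-matchʳ i j with j Finₚ.≟ i
... | yes j≡i = j≡i
... | no  _   rewrite dec-true (j Finₚ.≟ j) refl = refl

transpose-other : ∀ {n} {i j k : Fin n} → k ≢ i → k ≢ j → PC.transpose i j k ≡ k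
transpose-other {i = i} {j} {k} k≢i k≢j rewrite dec-false (k Finₚ.≟ i) k≢i | dec-false (k Finₚ.≟ j) k≢j = refl

-- (a x)(b y), with (b y) applied first
transpose₂ : ∀ {n} → Fin n → Fin n → Fin n → Fin n → Permutation′ n
transpose₂ a x b y = transpose b y ∘ₚ transpose a x

module _ {n} (a x b y : Fin n) where

  transpose₂-fix : ∀ {z} → z ≢ a → z ≢ x → z ≢ b → z ≢ y → transpose₂ a x b y ⟨$⟩ʳ z ≡ z
  transpose₂-fix z≢a z≢x z≢b z≢y rewrite transpose-other z≢b z≢y = transpose-other z≢a z≢x

  transpose₂-first : x ≢ b → x ≢ y → transpose₂ a x b y ⟨$⟩ʳ x ≡ a
  transpose₂-first x≢b x≢y rewrite transpose-other x≢b x≢y = transpose-matchʳ a x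

  transpose₂-second : b ≢ a → b ≢ x → transpose₂ a x b y ⟨$⟩ʳ y ≡ b
  transpose₂-second b≢a b≢x rewrite transpose-matchʳ b y = transpose-other b≢a b≢x

-- Counting points and pairs

count : ∀ {n} → (Fin n → Bool) → ℕ
count {n} p = ∑[ i < n ] ⟦ p i ⟧

count-complement : ∀ {n} (p : Fin n → Bool) → count p + count (not ∘ p) ≡ n
count-complement {n} p = begin
  count p + count (not ∘ p)           ≡⟨ ∑-distrib-+ (⟦_⟧ ∘ p) (⟦_⟧ ∘ not ∘ p) ⟨
  ∑[ i < n ] (⟦ p i ⟧ + ⟦ not (p i) ⟧) ≡⟨ sum-cong-≗ (λ i → one-of (p i)) ⟩
  ∑[ i < n ] 1                        ≡⟨ ∑-ones n ⟩
  n                                   ∎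
  where
  open ≡-Reasoning
  one-of : ∀ b → ⟦ b ⟧ + ⟦ not b ⟧ ≡ 1
  one-of true  = refl
  one-of false = refl

count-without : ∀ {n} (p q : Fin n → Bool) → count p ≤ count (λ i → p i ∧ not (q i)) + count q
count-without {n} p q = begin
  count p                                          ≤⟨ ∑-mono-≤ (λ i → split (p i) (q i)) ⟩
  ∑[ i < n ] (⟦ p i ∧ not (q i) ⟧ + ⟦ q i ⟧)        ≡⟨ ∑-distrib-+ (λ i → ⟦ p i ∧ not (q i) ⟧) (⟦_⟧ ∘ q) ⟩
  count (λ i → p i ∧ not (q i)) + count q          ∎
  where
  open ≤-Reasoning
  split : ∀ a b → ⟦ a ⟧ ≤ ⟦ a ∧ not b ⟧ + ⟦ b ⟧
  split true  true  = s≤s z≤n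
  split true  false = s≤s z≤n
  split false b     = z≤n

count-without-point : ∀ {n} (p : Fin n → Bool) (c : Fin n) → count p ≤ count (λ i → p i ∧ not (c == i)) + 1
count-without-point p c =
  subst (count p ≤_) (cong (count (λ i → p i ∧ not (c == i)) +_) (∑-point c)) (count-without p (c ==_))

at-least-half : ∀ {n} (p : Fin n → Bool) → 2 * count p ≤ n → n ≤ 2 * count (not ∘ p)
at-least-half {n} p small = +-cancelˡ-≤ n n (2 * count (not ∘ p)) (begin
  n + n                                    ≡⟨ cong₂ _+_ (count-complement p) (count-complement p) ⟨
  (count p + count (not ∘ p)) + (count p + count (not ∘ p)) ≡⟨ rearrange (count p) (count (not ∘ p)) ⟩
  2 * count p + 2 * count (not ∘ p)        ≤⟨ +-monoˡ-≤ (2 * count (not ∘ p)) small ⟩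
  n + 2 * count (not ∘ p)                  ∎)
  where
  open ≤-Reasoning
  rearrange : ∀ a b → (a + b) + (a + b) ≡ 2 * a + 2 * b
  rearrange = solve-∀

offDiagonal : ∀ {n} → (Fin n → Bool) → (Fin n → Bool) → Fin n → Fin n → Bool
offDiagonal X Y x y = X x ∧ (Y y ∧ not (x == y))

below : ∀ {n} → (Fin n → Bool) → Fin n → Fin n → Bool
below q x y = (x <ᵇ y) ∧ (q x ∧ q y)

fresh-endpoint : ∀ {n} {x y x′ y′ : Fin n} → x Fin.< y → x′ Fin.< y′ → ¬ (x ≡ x′ × y ≡ y′) →
                 (x ≢ x′ × x ≢ y′) ⊎ (y ≢ x′ × y ≢ y′)
fresh-endpoint {x = x} {y} {x′} {y′} x<y x′<y′ different with x Finₚ.≟ x′ | x Finₚ.≟ y′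
... | no x≢x′ | no x≢y′ = inj₁ (x≢x′ , x≢y′)
... | yes refl | _      = inj₂ ((λ y≡x → Finₚ.<-irrefl (sym y≡x) x<y) , (λ y≡y′ → different (refl , y≡y′)))
... | no _ | yes refl   = inj₂ ((λ { refl → Finₚ.<-asym x<y x′<y′ }) , (λ y≡x → Finₚ.<-irrefl (sym y≡x) x<y))

-- each x ∈ X pairs with every y ∈ Y except possibly y = x
count*count≤offDiagonal : ∀ {n} (X Y : Fin n → Bool) → count X * count Y ≤ pairs (offDiagonal X Y) + count X
count*count≤offDiagonal {n} X Y = begin
  count X * count Y                                              ≡⟨ *-distribʳ-sum (count Y) (⟦_⟧ ∘ X) ⟩
  ∑[ x < n ] (⟦ X x ⟧ * count Y)                                  ≤⟨ ∑-mono-≤ row ⟩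
  ∑[ x < n ] (∑[ y < n ] ⟦ offDiagonal X Y x y ⟧ + ⟦ X x ⟧)        ≡⟨ ∑-distrib-+ (λ x → ∑[ y < n ] ⟦ offDiagonal X Y x y ⟧) (⟦_⟧ ∘ X) ⟩
  pairs (offDiagonal X Y) + count X                              ∎
  where
  open ≤-Reasoning
  row : ∀ x → ⟦ X x ⟧ * count Y ≤ ∑[ y < n ] ⟦ offDiagonal X Y x y ⟧ + ⟦ X x ⟧
  row x with X x
  ... | false = z≤n
  ... | true  = subst (_≤ ∑[ y < n ] ⟦ Y y ∧ not (x == y) ⟧ + 1) (sym (+-identityʳ (count Y)))
                       (count-without-point Y x)

offDiagonal≤2*below : ∀ {n} (q : Fin n → Bool) → pairs (offDiagonal q q) ≤ 2 * pairs (below q)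
offDiagonal≤2*below {n} q = begin
  pairs (offDiagonal q q)                                             ≤⟨ ∑-mono-≤ (λ x → ∑-mono-≤ (λ y → ordered x y)) ⟩
  ∑[ x < n ] ∑[ y < n ] (⟦ below q x y ⟧ + ⟦ below q y x ⟧)            ≡⟨ sum-cong-≗ (λ x → ∑-distrib-+ (λ y → ⟦ below q x y ⟧) _) ⟩
  ∑[ x < n ] (∑[ y < n ] ⟦ below q x y ⟧ + ∑[ y < n ] ⟦ below q y x ⟧) ≡⟨ ∑-distrib-+ (λ x → ∑[ y < n ] ⟦ below q x y ⟧) _ ⟩
  pairs (below q) + ∑[ x < n ] ∑[ y < n ] ⟦ below q y x ⟧             ≡⟨ cong (pairs (below q) +_) (∑-comm (λ x y → ⟦ below q y x ⟧)) ⟩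
  pairs (below q) + pairs (below q)                                   ≡⟨ cong (pairs (below q) +_) (+-identityʳ _) ⟨
  2 * pairs (below q)                                                 ∎
  where
  open ≤-Reasoning
  ordered : ∀ x y → ⟦ offDiagonal q q x y ⟧ ≤ ⟦ below q x y ⟧ + ⟦ below q y x ⟧
  ordered x y = ≤-trans (⟦⟧-mono (Equivalence.from (T-∨ {below q x y}) ∘ by-order)) (⟦∨⟧≤ (below q x y) _)
    where
    by-order : T (offDiagonal q q x y) → T (below q x y) ⊎ T (below q y x)
    by-order t
      with qx , rest ← Equivalence.to (T-∧ {q x}) t
      with qy , x≢y  ← Equivalence.to (T-∧ {q y}) rest
      with Finₚ.<-cmp x y
    ... | tri< x<y _ _ = inj₁ (Equivalence.from (T-∧ {x <ᵇ y}) (fromWitness x<y , Equivalence.from T-∧ (qx , qy)))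
    ... | tri≈ _ x≡y _ = ⊥-elim (toWitnessFalse x≢y x≡y)
    ... | tri> _ _ y<x = inj₂ (Equivalence.from (T-∧ {y <ᵇ x}) (fromWitness y<x , Equivalence.from T-∧ (qy , qx)))

count*count≤below : ∀ {n} (q : Fin n → Bool) → count q * count q ≤ 2 * pairs (below q) + count q
count*count≤below q = ≤-trans (count*count≤offDiagonal q q) (+-monoˡ-≤ (count q) (offDiagonal≤2*below q))

square-bound : ∀ {n A B N} → 16 ≤ n → n ≤ 2 * A + 4 → n ≤ 2 * B + 4 → A * B ≤ 2 * N + A → n * n ≤ 32 * N
square-bound {n} {A} {B} {N} 16≤n n≤2A+4 n≤2B+4 AB≤2N+A
  with a , refl ← m≤n⇒∃[o]m+o≡n {6} {A} (*-cancelˡ-≤ 2 (+-cancelʳ-≤ 4 12 (2 * A) (≤-trans 16≤n n≤2A+4)))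
  with b , refl ← m≤n⇒∃[o]m+o≡n {6} {B} (*-cancelˡ-≤ 2 (+-cancelʳ-≤ 4 12 (2 * B) (≤-trans 16≤n n≤2B+4)))
  = +-cancelʳ-≤ (16 * A) (n * n) (32 * N) (begin
  n * n + 16 * A                                  ≤⟨ +-monoˡ-≤ (16 * A) (*-mono-≤ n≤2A+4 n≤2B+4) ⟩
  (2 * A + 4) * (2 * B + 4) + 16 * A              ≤⟨ m≤m+n _ slack ⟩
  (2 * A + 4) * (2 * B + 4) + 16 * A + slack      ≡⟨ expand a b ⟩
  16 * (A * B)                                    ≤⟨ *-monoʳ-≤ 16 AB≤2N+A ⟩
  16 * (2 * N + A)                                ≡⟨ distribute N A ⟩
  32 * N + 16 * A                                 ∎)
  where
  open ≤-Reasoning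
  -- for A = 6 + a and B = 6 + b, slack = 16AB − (2A + 4)(2B + 4) − 16A
  slack : ℕ
  slack = 224 + 48 * a + 64 * b + 12 * (a * b)
  expand : ∀ a b → (2 * (6 + a) + 4) * (2 * (6 + b) + 4) + 16 * (6 + a)
                   + (224 + 48 * a + 64 * b + 12 * (a * b)) ≡ 16 * ((6 + a) * (6 + b))
  expand = solve-∀
  distribute : ∀ N A → 16 * (2 * N + A) ≡ 32 * N + 16 * A
  distribute = solve-∀

-- Three separating families

module Parts {n} (P : Partition n) where

  infix 4 _~_
  _~_ : Fin n → Fin n → Set
  i ~ j = T (same P i j)

  ~-sym : ∀ {i j} → i ~ j → j ~ i
  ~-sym = symP P _ _

  ~-trans : ∀ {i j k} → i ~ j → j ~ k → i ~ k
  ~-trans = transP P _ _ _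

  ≁⇒≢ : ∀ {a b} → ¬ a ~ b → a ≢ b
  ≁⇒≢ {a} a≁b refl = a≁b (reflP P a)

  ~-≁⇒≢ : ∀ {a b c} → a ~ b → ¬ a ~ c → b ≢ c
  ~-≁⇒≢ a~b a≁c refl = a≁c a~b

  joined-pair : ¬ IsDiscrete P → ∃₂ λ u v → u ≢ v × u ~ v
  joined-pair ¬discrete with Finₚ.any? (λ u → Finₚ.any? (λ v → ¬? (u Finₚ.≟ v) ×-dec T? (same P u v)))
  ... | yes (u , v , pair) = u , v , pair
  ... | no  none = contradiction discrete ¬discrete
    where
    discrete : IsDiscrete P
    discrete i j = T-injective
      (λ i~j → fromWitness (decidable-stable (i Finₚ.≟ j) (λ i≢j → none (i , j , i≢j , i~j))))
      (λ i≡j → subst (i ~_) (toWitness i≡j) (reflP P i))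

  separatedBy : ∀ {σ σ′} i j → σ i ~ σ j → ¬ σ′ i ~ σ′ j → Distinguishes P σ σ′
  separatedBy i j joined split = i , j , λ e → split (subst T e joined)

  separatedBy′ : ∀ {σ σ′} i j → ¬ σ i ~ σ j → σ′ i ~ σ′ j → Distinguishes P σ σ′
  separatedBy′ i j split joined = i , j , λ e → split (subst T (sym e) joined)

  offDiagonal⁻ : ∀ (X Y : Fin n → Bool) {x y} → T (offDiagonal X Y x y) → T (X x) × T (Y y) × x ≢ y
  offDiagonal⁻ X Y {x} {y} t
    with Xx , rest ← Equivalence.to (T-∧ {X x}) t
    with Yy , x≢y  ← Equivalence.to (T-∧ {Y y}) rest
    = Xx , Yy , toWitnessFalse x≢y

  below⁻ : ∀ (q : Fin n → Bool) {x y} → T (below q x y) → x Fin.< y × T (q x) × T (q y)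
  below⁻ q {x} {y} t with x<y , rest ← Equivalence.to (T-∧ {x <ᵇ y}) t
    = toWitness x<y , Equivalence.to (T-∧ {q x}) rest

module BigPart {n} (P : Partition n) (t w₁ w₂ : Fin n) (w₁≢w₂ : w₁ ≢ w₂)
               (t≁w₁ : ¬ T (same P t w₁)) (t≁w₂ : ¬ T (same P t w₂))
               (big : n < 2 * count (same P t)) where

  open Parts P

  -- t is left out so that every ρ x y fixes it
  inPart : Fin n → Bool
  inPart x = same P t x ∧ not (t == x)

  inPart⁻ : ∀ {x} → T (inPart x) → t ~ x × t ≢ x
  inPart⁻ {x} inx with t~x , t≢x ← Equivalence.to (T-∧ {same P t x}) inx = t~x , toWitnessFalse t≢x

  ρ : Fin n → Fin n → Permutation′ n
  ρ x y = transpose₂ w₁ x w₂ y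

  fixes : ∀ {x y z} → t ~ z → z ≢ x → z ≢ y → ρ x y ⟨$⟩ʳ z ≡ z
  fixes {x} {y} t~z z≢x z≢y = transpose₂-fix w₁ x w₂ y (~-≁⇒≢ t~z t≁w₁) z≢x (~-≁⇒≢ t~z t≁w₂) z≢y

  fixes-t : ∀ {x y} → T (below inPart x y) → ρ x y ⟨$⟩ʳ t ≡ t
  fixes-t m with _ , inx , iny ← below⁻ inPart m = fixes (reflP P t) (proj₂ (inPart⁻ inx)) (proj₂ (inPart⁻ iny))

  ends : ∀ {x y} → T (below inPart x y) → ρ x y ⟨$⟩ʳ x ≡ w₁ × ρ x y ⟨$⟩ʳ y ≡ w₂
  ends {x} {y} m with x<y , inx , _ ← below⁻ inPart m
    = transpose₂-first w₁ x w₂ y x≢w₂ (Finₚ.<⇒≢ x<y) , transpose₂-second w₁ x w₂ y (≢-sym w₁≢w₂) (≢-sym x≢w₂)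
    where
    x≢w₂ : x ≢ w₂
    x≢w₂ = ~-≁⇒≢ (proj₁ (inPart⁻ inx)) t≁w₂

  moved-point-separates : ∀ {x y x′ y′ z} → T (below inPart x y) → T (below inPart x′ y′) →
    ρ x y ⟨$⟩ʳ z ≡ w₁ ⊎ ρ x y ⟨$⟩ʳ z ≡ w₂ → T (inPart z) → z ≢ x′ → z ≢ y′ →
    Distinguishes P (ρ x y ⟨$⟩ʳ_) (ρ x′ y′ ⟨$⟩ʳ_)
  moved-point-separates {x} {y} {x′} {y′} {z} m m′ moved inz z≢x′ z≢y′ = separatedBy′ z t split joined
    where
    t~z : t ~ z
    t~z = proj₁ (inPart⁻ inz)
    split : ¬ (ρ x y ⟨$⟩ʳ z) ~ (ρ x y ⟨$⟩ʳ t)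
    split ρz~ρt = [ (λ e → t≁w₁ (~-sym (subst₂ _~_ e (fixes-t m) ρz~ρt)))
                  , (λ e → t≁w₂ (~-sym (subst₂ _~_ e (fixes-t m) ρz~ρt))) ]′ moved
    joined : (ρ x′ y′ ⟨$⟩ʳ z) ~ (ρ x′ y′ ⟨$⟩ʳ t)
    joined = subst₂ _~_ (sym (fixes t~z z≢x′ z≢y′)) (sym (fixes-t m′)) (~-sym t~z)

  separates : ∀ {x y x′ y′} → T (below inPart x y) → T (below inPart x′ y′) → ¬ (x ≡ x′ × y ≡ y′) →
              Distinguishes P (ρ x y ⟨$⟩ʳ_) (ρ x′ y′ ⟨$⟩ʳ_)
  separates {x} {y} m m′ different
    with x<y , inx , iny ← below⁻ inPart m | x′<y′ , _ ← below⁻ inPart m′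
    with fresh-endpoint x<y x′<y′ different
  ... | inj₁ (x≢x′ , x≢y′) = moved-point-separates m m′ (inj₁ (proj₁ (ends {x} {y} m))) inx x≢x′ x≢y′
  ... | inj₂ (y≢x′ , y≢y′) = moved-point-separates m m′ (inj₂ (proj₂ (ends {x} {y} m))) iny y≢x′ y≢y′

  family : SeparatingFamily P
  family = record { member = below inPart ; ρ = ρ ; separates = separates }

  large : 16 ≤ n → n * n ≤ 32 * pairs (below inPart)
  large 16≤n = square-bound {N = pairs (below inPart)} 16≤n n≤2A+4 n≤2A+4 (count*count≤below inPart)
    where
    open ≤-Reasoning
    n≤2A+4 : n ≤ 2 * count inPart + 4
    n≤2A+4 = begin
      n                            ≤⟨ <⇒≤ big ⟩
      2 * count (same P t)         ≤⟨ *-monoʳ-≤ 2 (count-without-point (same P t) t) ⟩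
      2 * (count inPart + 1)       ≡⟨ *-distribˡ-+ 2 (count inPart) 1 ⟩
      2 * count inPart + 2         ≤⟨ +-monoʳ-≤ (2 * count inPart) (s≤s (s≤s z≤n)) ⟩
      2 * count inPart + 4         ∎

module OnePart {n} (P : Partition n) (u v : Fin n) (u≢v : u ≢ v) (u~v : T (same P u v))
               (only-part : ∀ {a b} → a ≢ b → T (same P a b) → T (same P u a))
               (small : 2 * count (same P u) ≤ n) where

  open Parts P

  outside : Fin n → Bool
  outside x = not (same P u x)

  singleton : ∀ {z w} → ¬ u ~ z → z ~ w → z ≡ w
  singleton {z} {w} u≁z z~w with z Finₚ.≟ w
  ... | yes z≡w = z≡w
  ... | no  z≢w = contradiction (only-part z≢w z~w) u≁z

  ρ : Fin n → Fin n → Permutation′ n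
  ρ x y = transpose₂ u x v y

  fixes : ∀ {x y z} → ¬ u ~ z → z ≢ x → z ≢ y → ρ x y ⟨$⟩ʳ z ≡ z
  fixes {x} {y} u≁z z≢x z≢y = transpose₂-fix u x v y (≢-sym (≁⇒≢ u≁z)) z≢x (≢-sym (~-≁⇒≢ u~v u≁z)) z≢y

  pair-separates : ∀ {x y x′ y′ z w} → (ρ x y ⟨$⟩ʳ z) ~ (ρ x y ⟨$⟩ʳ w) →
                   ¬ u ~ z → w ≢ z → z ≢ x′ → z ≢ y′ → Distinguishes P (ρ x y ⟨$⟩ʳ_) (ρ x′ y′ ⟨$⟩ʳ_)
  pair-separates {x′ = x′} {y′} {z} {w} joined u≁z w≢z z≢x′ z≢y′ = separatedBy z w joined split
    where
    z-fixed : ρ x′ y′ ⟨$⟩ʳ z ≡ z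
    z-fixed = fixes u≁z z≢x′ z≢y′
    split : ¬ (ρ x′ y′ ⟨$⟩ʳ z) ~ (ρ x′ y′ ⟨$⟩ʳ w)
    split z~ρw = w≢z (Injection.injective (↔⇒↣ (ρ x′ y′))
                   (trans (sym (singleton u≁z (subst (_~ _) z-fixed z~ρw))) (sym z-fixed)))

  ends : ∀ {x y} → T (below outside x y) → ρ x y ⟨$⟩ʳ x ≡ u × ρ x y ⟨$⟩ʳ y ≡ v
  ends {x} {y} m with x<y , out-x , _ ← below⁻ outside m
    = transpose₂-first u x v y (≢-sym (~-≁⇒≢ u~v (T-not⁻ out-x))) (Finₚ.<⇒≢ x<y)
    , transpose₂-second u x v y (≢-sym u≢v) (~-≁⇒≢ u~v (T-not⁻ out-x))

  separates : ∀ {x y x′ y′} → T (below outside x y) → T (below outside x′ y′) → ¬ (x ≡ x′ × y ≡ y′) →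
              Distinguishes P (ρ x y ⟨$⟩ʳ_) (ρ x′ y′ ⟨$⟩ʳ_)
  separates {x} {y} m m′ different
    with x<y , out-x , out-y ← below⁻ outside m | x′<y′ , _ ← below⁻ outside m′
    with ρx≡u , ρy≡v ← ends {x} {y} m
    with fresh-endpoint x<y x′<y′ different
  ... | inj₁ (x≢x′ , x≢y′) =
    pair-separates (subst₂ _~_ (sym ρx≡u) (sym ρy≡v) u~v) (T-not⁻ out-x) (≢-sym (Finₚ.<⇒≢ x<y)) x≢x′ x≢y′
  ... | inj₂ (y≢x′ , y≢y′) =
    pair-separates (subst₂ _~_ (sym ρy≡v) (sym ρx≡u) (~-sym u~v)) (T-not⁻ out-y) (Finₚ.<⇒≢ x<y) y≢x′ y≢y′

  family : SeparatingFamily P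
  family = record { member = below outside ; ρ = ρ ; separates = separates }

  large : 16 ≤ n → n * n ≤ 32 * pairs (below outside)
  large 16≤n = square-bound {N = pairs (below outside)} 16≤n n≤2A+4 n≤2A+4 (count*count≤below outside)
    where
    n≤2A+4 : n ≤ 2 * count outside + 4
    n≤2A+4 = ≤-trans (at-least-half (same P u) small) (m≤m+n _ 4)

module TwoParts {n} (P : Partition n) (u v u′ v′ : Fin n) (u≢v : u ≢ v) (u~v : T (same P u v))
                (u′≢v′ : u′ ≢ v′) (u′~v′ : T (same P u′ v′)) (u≁u′ : ¬ T (same P u u′))
                (small : ∀ s → 2 * count (same P s) ≤ n) where

  open Parts P

  avoiding : Fin n → Fin n → Fin n → Fin n → Bool
  avoiding s a b x = (not (same P s x) ∧ not (a == x)) ∧ not (b == x)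

  avoiding⁻ : ∀ {s a b x} → T (avoiding s a b x) → ¬ s ~ x × a ≢ x × b ≢ x
  avoiding⁻ {s} {a} {b} {x} t
    with rest , b≢x ← Equivalence.to (T-∧ {not (same P s x) ∧ not (a == x)}) t
    with s≁x , a≢x ← Equivalence.to (T-∧ {not (same P s x)}) rest
    = T-not⁻ s≁x , toWitnessFalse a≢x , toWitnessFalse b≢x

  avoiding-large : ∀ s a b → n ≤ 2 * count (avoiding s a b) + 4
  avoiding-large s a b = begin
    n                                                           ≤⟨ at-least-half (same P s) (small s) ⟩
    2 * count (not ∘ same P s)                                  ≤⟨ *-monoʳ-≤ 2 (count-without-point _ a) ⟩
    2 * (count (λ x → not (same P s x) ∧ not (a == x)) + 1)     ≤⟨ *-monoʳ-≤ 2 (+-monoˡ-≤ 1 (count-without-point _ b)) ⟩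
    2 * (count (avoiding s a b) + 1 + 1)                        ≡⟨ double (count (avoiding s a b)) ⟩
    2 * count (avoiding s a b) + 4                              ∎
    where
    open ≤-Reasoning
    double : ∀ c → 2 * (c + 1 + 1) ≡ 2 * c + 4
    double = solve-∀

  -- avoiding u′, v′ and u, v makes every ρ x y fix v and v′
  X Y : Fin n → Bool
  X = avoiding u u′ v′
  Y = avoiding u′ u v

  ρ : Fin n → Fin n → Permutation′ n
  ρ x y = transpose₂ u x u′ y

  v-fixed : ∀ {x y} → T (offDiagonal X Y x y) → ρ x y ⟨$⟩ʳ v ≡ v
  v-fixed {x} {y} m
    with Xx , Yy , _ ← offDiagonal⁻ X Y m
    with u≁x , _ ← avoiding⁻ Xx | _ , _ , v≢y ← avoiding⁻ Yy
    = transpose₂-fix u x u′ y (≢-sym u≢v) (~-≁⇒≢ u~v u≁x) (~-≁⇒≢ u~v u≁u′) v≢y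

  v′-fixed : ∀ {x y} → T (offDiagonal X Y x y) → ρ x y ⟨$⟩ʳ v′ ≡ v′
  v′-fixed {x} {y} m
    with Xx , Yy , _ ← offDiagonal⁻ X Y m
    with _ , _ , v′≢x ← avoiding⁻ Xx | u′≁y , _ ← avoiding⁻ Yy
    = transpose₂-fix u x u′ y (~-≁⇒≢ u′~v′ (u≁u′ ∘ ~-sym)) v′≢x (≢-sym u′≢v′) (~-≁⇒≢ u′~v′ u′≁y)

  separates : ∀ {x y x′ y′} → T (offDiagonal X Y x y) → T (offDiagonal X Y x′ y′) → ¬ (x ≡ x′ × y ≡ y′) →
              Distinguishes P (ρ x y ⟨$⟩ʳ_) (ρ x′ y′ ⟨$⟩ʳ_)
  separates {x} {y} {x′} {y′} m m′ different
    with Xx , Yy , x≢y ← offDiagonal⁻ X Y m | Xx′ , _ ← offDiagonal⁻ X Y m′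
    with u≁x , u′≢x , _ ← avoiding⁻ Xx | u′≁y , u≢y , _ ← avoiding⁻ Yy | _ , u′≢x′ , _ ← avoiding⁻ Xx′
    with x Finₚ.≟ x′
  ... | no x≢x′ = separatedBy x v joined split
    where
    joined : (ρ x y ⟨$⟩ʳ x) ~ (ρ x y ⟨$⟩ʳ v)
    joined = subst₂ _~_ (sym (transpose₂-first u x u′ y (≢-sym u′≢x) x≢y)) (sym (v-fixed m)) u~v
    image-outside : ¬ u ~ (ρ x′ y′ ⟨$⟩ʳ x)
    image-outside with x Finₚ.≟ y′
    ... | yes refl = subst (¬_ ∘ (u ~_)) (sym (transpose₂-second u x′ u′ x (≢-sym (≁⇒≢ u≁u′)) u′≢x′)) u≁u′
    ... | no x≢y′  = subst (¬_ ∘ (u ~_)) (sym (transpose₂-fix u x′ u′ y′ (≢-sym (≁⇒≢ u≁x)) x≢x′ (≢-sym u′≢x) x≢y′)) u≁x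
    split : ¬ (ρ x′ y′ ⟨$⟩ʳ x) ~ (ρ x′ y′ ⟨$⟩ʳ v)
    split ρx~ρv = image-outside (~-trans u~v (~-sym (subst (_ ~_) (v-fixed m′) ρx~ρv)))
  ... | yes refl = separatedBy y v′ joined split
    where
    y≢y′ : y ≢ y′
    y≢y′ y≡y′ = different (refl , y≡y′)
    joined : (ρ x y ⟨$⟩ʳ y) ~ (ρ x y ⟨$⟩ʳ v′)
    joined = subst₂ _~_ (sym (transpose₂-second u x u′ y (≢-sym (≁⇒≢ u≁u′)) u′≢x)) (sym (v′-fixed m)) u′~v′
    y-fixed : ρ x y′ ⟨$⟩ʳ y ≡ y
    y-fixed = transpose₂-fix u x u′ y′ (≢-sym u≢y) (≢-sym x≢y) (≢-sym (≁⇒≢ u′≁y)) y≢y′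
    split : ¬ (ρ x y′ ⟨$⟩ʳ y) ~ (ρ x y′ ⟨$⟩ʳ v′)
    split ρy~ρv′ = u′≁y (~-trans u′~v′ (~-sym (subst₂ _~_ y-fixed (v′-fixed m′) ρy~ρv′)))

  family : SeparatingFamily P
  family = record { member = offDiagonal X Y ; ρ = ρ ; separates = separates }

  large : 16 ≤ n → n * n ≤ 32 * pairs (offDiagonal X Y)
  large 16≤n = square-bound {N = pairs (offDiagonal X Y)} 16≤n (avoiding-large u u′ v′) (avoiding-large u′ u v)
    (begin
    count X * count Y                     ≤⟨ count*count≤offDiagonal X Y ⟩
    pairs (offDiagonal X Y) + count X     ≤⟨ +-monoˡ-≤ (count X) (m≤n*m (pairs (offDiagonal X Y)) 2) ⟩
    2 * pairs (offDiagonal X Y) + count X ∎)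
    where open ≤-Reasoning

-- The orbit bound

Exceptional : ∀ {n} → Partition n → Set
Exceptional P = IsTrivial P ⊎ IsPointSplit P ⊎ IsDiscrete P

LargeFamily : ∀ {n} → Partition n → Set
LargeFamily {n} P = ∃ λ (F : SeparatingFamily P) → n * n ≤ 32 * SeparatingFamily.size F

module _ {n} (P : Partition n) (16≤n : 16 ≤ n) where

  open Parts P

  bigPartFamily : ∀ t → n < 2 * count (same P t) → ¬ IsTrivial P → ¬ IsPointSplit P → LargeFamily P
  bigPartFamily t big ¬trivial ¬split with Finₚ.any? (λ w → ¬? (T? (same P t w)))
  ... | no none = contradiction trivial ¬trivial
    where
    t~ : ∀ w → t ~ w
    t~ w = decidable-stable (T? _) (λ t≁w → none (w , t≁w))
    trivial : IsTrivial P
    trivial i j = Equivalence.to T-≡ (~-trans (~-sym (t~ i)) (t~ j))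
  ... | yes (w₁ , t≁w₁) with Finₚ.any? (λ w → ¬? (w Finₚ.≟ w₁) ×-dec ¬? (T? (same P t w)))
  ...   | yes (w₂ , w₂≢w₁ , t≁w₂) = BigPart.family P t w₁ w₂ (≢-sym w₂≢w₁) t≁w₁ t≁w₂ big
                                  , BigPart.large P t w₁ w₂ (≢-sym w₂≢w₁) t≁w₁ t≁w₂ big 16≤n
  ...   | no  none = contradiction point-split ¬split
    where
    t~ : ∀ {w} → w ≢ w₁ → t ~ w
    t~ w≢w₁ = decidable-stable (T? _) (λ t≁w → none (_ , w≢w₁ , t≁w))
    -- the type is read off point-split below: the xor in IsPointSplit is local to Defs
    split-at-w₁ : ∀ i j → _
    point-split : IsPointSplit P
    point-split = w₁ , split-at-w₁
    split-at-w₁ i j with i Finₚ.≟ w₁ | j Finₚ.≟ w₁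
    ... | yes refl | yes refl = Equivalence.to T-≡ (reflP P i)
    ... | yes refl | no  j≢w₁ = ¬T⇒≡false (λ w₁~j → t≁w₁ (~-trans (t~ j≢w₁) (~-sym w₁~j)))
    ... | no  i≢w₁ | yes refl = ¬T⇒≡false (λ i~w₁ → t≁w₁ (~-trans (t~ i≢w₁) i~w₁))
    ... | no  i≢w₁ | no  j≢w₁ = Equivalence.to T-≡ (~-trans (~-sym (t~ i≢w₁)) (t~ j≢w₁))

  smallPartsFamily : ∀ {u v} → u ≢ v → u ~ v → (∀ s → 2 * count (same P s) ≤ n) → LargeFamily P
  smallPartsFamily {u} {v} u≢v u~v small
    with Finₚ.any? (λ a → Finₚ.any? (λ b → ¬? (a Finₚ.≟ b) ×-dec (T? (same P a b) ×-dec ¬? (T? (same P u a)))))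
  ... | yes (u′ , v′ , u′≢v′ , u′~v′ , u≁u′) = TwoParts.family P u v u′ v′ u≢v u~v u′≢v′ u′~v′ u≁u′ small
                                             , TwoParts.large P u v u′ v′ u≢v u~v u′≢v′ u′~v′ u≁u′ small 16≤n
  ... | no  none = OnePart.family P u v u≢v u~v only-part (small u)
                 , OnePart.large P u v u≢v u~v only-part (small u) 16≤n
    where
    only-part : ∀ {a b} → a ≢ b → a ~ b → u ~ a
    only-part a≢b a~b = decidable-stable (T? _) (λ u≁a → none (_ , _ , a≢b , a~b , u≁a))

  largeFamily : ¬ Exceptional P → LargeFamily P
  largeFamily exceptional with u , v , u≢v , u~v ← joined-pair (exceptional ∘ inj₂ ∘ inj₂)
    with Finₚ.any? (λ t → n <? 2 * count (same P t))
  ... | yes (t , big) = bigPartFamily t big (exceptional ∘ inj₁) (exceptional ∘ inj₂ ∘ inj₁)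
  ... | no  none      = smallPartsFamily u≢v u~v (λ s → ≮⇒≥ (λ big → none (s , big)))

symStabSize≤n! : ∀ {n} (P : Partition n) → symStabSize P ≤ n !
symStabSize≤n! {n} P = ≤-trans (sumₗ-mono-≤ (λ σ → ⟦⟧-mono (proj₁ ∘ Equivalence.to (T-∧ {isPermᵇ σ}))) (allFuns n n))
                               (∑Fun-permutations≤ n)

n²*symStabSize≤ : ∀ {n} (P : Partition n) → ¬ Exceptional P → n * n * symStabSize P ≤ 256 * n !
n²*symStabSize≤ {n} P exceptional with n <? 16
... | yes n<16 = *-mono-≤ (*-mono-≤ (<⇒≤ n<16) (<⇒≤ n<16)) (symStabSize≤n! P)
... | no  n≮16 with F , n²≤32size ← largeFamily P (≮⇒≥ n≮16) exceptional = begin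
  n * n * symStabSize P                          ≤⟨ *-monoˡ-≤ (symStabSize P) n²≤32size ⟩
  32 * SeparatingFamily.size F * symStabSize P   ≡⟨ *-assoc 32 (SeparatingFamily.size F) (symStabSize P) ⟩
  32 * (SeparatingFamily.size F * symStabSize P) ≤⟨ *-monoʳ-≤ 32 (packing F) ⟩
  32 * n !                                       ≤⟨ *-monoˡ-≤ (n !) (m≤m+n 32 224) ⟩
  256 * n !                                      ∎
  where open ≤-Reasoning

n!≡2*[n!/2] : ∀ {n} → 2 ≤ n → n ! ≡ 2 * (n ! / 2)
n!≡2*[n!/2] {n} 2≤n = trans (m∣n⇒n≡m*quotient 2∣n!) (cong (2 *_) (sym (n/m≡quotient 2∣n!)))
  where
  2∣n! : 2 ∣ n !
  2∣n! = m≤n⇒m!∣n! 2≤n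

lemma8p12 : Σ ℕ λ K → (1 ≤ K) × (∀ (n : ℕ) → 4 ≤ n → (P : Partition n) →
    ¬ (IsTrivial P ⊎ IsPointSplit P ⊎ IsDiscrete P) →
    n ^ 2 * stabSize P ≤ K * ((n !) / 2))
lemma8p12 = 512 , s≤s z≤n , λ n 4≤n P exceptional → begin
  n ^ 2 * stabSize P         ≡⟨ cong (λ m → n * m * stabSize P) (*-identityʳ n) ⟩
  n * n * stabSize P         ≤⟨ *-monoʳ-≤ (n * n) (stabSize≤symStabSize P) ⟩
  n * n * symStabSize P      ≤⟨ n²*symStabSize≤ P exceptional ⟩
  256 * n !                  ≡⟨ cong (256 *_) (n!≡2*[n!/2] (≤-trans (s≤s (s≤s z≤n)) 4≤n)) ⟩
  256 * (2 * (n ! / 2))      ≡⟨ *-assoc 256 2 (n ! / 2) ⟨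
  512 * (n ! / 2)            ∎
  where open ≤-Reasoning
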